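{- Let $(X,\mathcal{B})$ be a segregated $(n,k,p,2;j)$-lottery design with exactly $r$ isolated blocks, let $I$ be a maximal (with respect to inclusion) independent set, let $\mathcal{B}_I$ be the set of blocks meeting $I$, and let $F_I$ be the set of vertices of degree at least $2$ that lie in exactly one block of $\mathcal{B}_I$. Then \[|F_I|\ge 2n-2p+2-(k-1)(|\mathcal{B}_I|+r).\]
   Context: An $(n,k,p,t;j)$-lottery design is a $k$-uniform hypergraph $(X,\mathcal{B})$ (all blocks of size $k$, $n\ge k\ge t\ge2$) with $|X|=n$, $|\mathcal{B}|=j$, such that every $D\subseteq X$ with $|D|=p$ satisfies $|B\cap D|\ge t$ for some $B\in\mathcal{B}$. The degree of a vertex is the number of blocks containing it. Two vertices are adjacent if they lie in a common block; an independent set is a set of pairwise non-adjacent vertices. A block is isolated if it is disjoint from every other block; the design is segregated if no vertex has degree $0$ and every vertex of degree $1$ lies in an isolated block. -}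

module Defs where

open import Data.Nat using (ℕ; _≤_)
open import Data.Fin using (Fin)
open import Data.Fin.Subset using (Subset; _∈_; _∉_; _∩_; _⊆_; ∣_∣; Nonempty; Empty)
open import Data.Fin.Subset.Properties using (_∈?_)
open import Data.Vec using (tabulate)
open import Data.Product using (Σ; ∃; _×_)
open import Relation.Nullary using (¬_; does)
open import Relation.Binary.PropositionalEquality using (_≡_; _≢_)
open import Function.Definitions using (Injective)

-- A hypergraph on vertex set Fin n with j blocks, given as an injective
-- family  B : Fin j → Subset n  (injective = the blocks form a *set* of size j).

module _ {n j : ℕ} (B : Fin j → Subset n) where

  Uniform : ℕ → Set
  Uniform k = ∀ b → ∣ B b ∣ ≡ k

  -- (n,k,p,t;j)-lottery design (together with Uniform k and Injective B)
  Lottery : (p t : ℕ) → Set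
  Lottery p t = ∀ (D : Subset n) → ∣ D ∣ ≡ p → ∃ λ b → t ≤ ∣ B b ∩ D ∣

  blocksOf : Fin n → Subset j
  blocksOf v = tabulate (λ b → does (v ∈? B b))

  degree : Fin n → ℕ
  degree v = ∣ blocksOf v ∣

  Adjacent : Fin n → Fin n → Set
  Adjacent u v = ∃ λ b → u ∈ B b × v ∈ B b

  Independent : Subset n → Set
  Independent I = ∀ u v → u ∈ I → v ∈ I → u ≢ v → ¬ Adjacent u v

  MaximalIndependent : Subset n → Set
  MaximalIndependent I =
    Independent I × (∀ J → Independent J → I ⊆ J → J ⊆ I)

  Isolated : Fin j → Set
  Isolated b = ∀ b' → b' ≢ b → Empty (B b ∩ B b')

  Segregated : Set
  Segregated =
    (∀ v → 1 ≤ degree v) ×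
    (∀ v → degree v ≡ 1 → ∃ λ b → v ∈ B b × Isolated b)

  IsIsolatedBlocks : Subset j → Set
  IsIsolatedBlocks S = ∀ b → (b ∈ S → Isolated b) × (Isolated b → b ∈ S)

  IsBlocksMeeting : Subset n → Subset j → Set
  IsBlocksMeeting I BI = ∀ b → (b ∈ BI → Nonempty (B b ∩ I)) × (Nonempty (B b ∩ I) → b ∈ BI)

  InExactlyOne : Subset j → Fin n → Set
  InExactlyOne BI v =
    ∃ λ b → b ∈ BI × v ∈ B b × (∀ b' → b' ∈ BI → v ∈ B b' → b' ≡ b)

  IsF : Subset j → Subset n → Set
  IsF BI F = ∀ v → (v ∈ F → 2 ≤ degree v × InExactlyOne BI v)
                 × (2 ≤ degree v × InExactlyOne BI v → v ∈ F)

-- Double counting.  A block meeting the independent set I meets it in exactly one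
-- vertex, so it has k − 1 vertices outside I; isolated blocks meet I by maximality.
-- Hence the pairs (v, b) with v ∉ I and b ∈ B_I, together with those with b isolated,
-- number (k − 1)(|B_I| + r).  Conversely every v ∉ I lies in a block of B_I
-- (maximality), and if it lies in only one and is not in F, then it has degree 1
-- and so lies in an isolated block: every v ∉ I is counted at least 2 − [v ∈ F]
-- times.  Finally |I| < p, since p vertices of I would put two of them in a common
-- block.  So 2(n − p + 1) ≤ 2|∁ I| ≤ (k − 1)(|B_I| + r) + |F|.

module Submission where

open import Defs
open import Data.Nat using (ℕ; _≤_; _∸_)
open import Data.Integer using (ℤ; +_; _-_; _≥_)
open import Data.Fin using (Fin)
open import Data.Fin.Subset using (Subset; ∣_∣)
open import Relation.Binary.PropositionalEquality using (_≡_)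
open import Function.Definitions using (Injective)

open import Data.Nat using (zero; suc; _+_; _*_; _<_; z≤n; s≤s; s≤s⁻¹; _≤?_)
open import Data.Nat.Properties hiding (_≟_)
open import Data.Bool using (true; false; if_then_else_)
open import Data.Fin using (zero; suc; _≟_)
import Data.Fin.Properties as Fin
open import Data.Fin.Subset using (_∈_; _∉_; _⊆_; _∩_; _∪_; ∁; ⁅_⁆; ⊥; inside; outside; Nonempty; Empty)
open import Data.Fin.Subset.Properties
  using (_∈?_; nonempty?; Empty-unique; ∣⊥∣≡0; ∉⊥; ∣p∣≤∣x∷p∣; ∣p∣≤n; ∣∁p∣≡n∸∣p∣; x∈p⇒∣p-x∣<∣p∣;
         x∈p∩q⁺; x∈p∩q⁻; x∈p∪q⁺; x∈p∪q⁻; p⊆p∪q; x∈⁅x⁆; x∈⁅y⁆⇒x≡y; x∈p⇒x∉∁p; x∉p⇒x∈∁p; ⊆-refl)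
open import Data.Vec using ([]; _∷_; lookup; here; there)
open import Data.Vec.Properties using ([]=⇒lookup; lookup⇒[]=; lookup∘tabulate)
open import Data.Product using (∃; _×_; _,_; proj₁; proj₂)
open import Data.Sum using (inj₁; inj₂)
open import Relation.Binary.PropositionalEquality using (refl; sym; trans; cong; cong₂; subst; module ≡-Reasoning)
open import Relation.Nullary using (yes; no; does; contradiction)
open import Algebra.Properties.Semiring.Sum +-*-semiring
  using (sum-syntax; sum-cong-≗; ∑-comm; ∑-distrib-+; *-distribˡ-sum; *-distribʳ-sum)
open import Data.Integer using (+≤+) renaming (_+_ to _+ℤ_; _≤_ to _≤ℤ_)
import Data.Integer.Properties as ℤₚ
open import Data.Integer.Tactic.RingSolver using (solve-∀)

private variable
  n j : ℕ
  x y : Fin n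
  p q : Subset n

χ : Subset n → Fin n → ℕ
χ p x = if lookup p x then 1 else 0

χ-∈ : x ∈ p → χ p x ≡ 1
χ-∈ x∈p rewrite []=⇒lookup x∈p = refl

χ-∉ : x ∉ p → χ p x ≡ 0
χ-∉ {x = x} {p = p} x∉p with lookup p x in eq
... | true  = contradiction (lookup⇒[]= x p eq) x∉p
... | false = refl

χ-cong : (x ∈ p → y ∈ q) → (y ∈ q → x ∈ p) → χ p x ≡ χ q y
χ-cong {x = x} {p = p} to from with x ∈? p
... | yes x∈p = trans (χ-∈ x∈p) (sym (χ-∈ (to x∈p)))
... | no  x∉p = trans (χ-∉ x∉p) (sym (χ-∉ (λ y∈q → x∉p (from y∈q))))

χ-∩ : ∀ (p q : Subset n) x → χ (p ∩ q) x ≡ χ p x * χ q x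
χ-∩ (inside  ∷ p) (inside  ∷ q) zero    = refl
χ-∩ (inside  ∷ p) (outside ∷ q) zero    = refl
χ-∩ (outside ∷ p) (_       ∷ q) zero    = refl
χ-∩ (_       ∷ p) (_       ∷ q) (suc x) = χ-∩ p q x

∣p∣≡∑χ : ∀ (p : Subset n) → ∣ p ∣ ≡ ∑[ i < n ] χ p i
∣p∣≡∑χ []            = refl
∣p∣≡∑χ (inside  ∷ p) = cong suc (∣p∣≡∑χ p)
∣p∣≡∑χ (outside ∷ p) = ∣p∣≡∑χ p

∣p∩q∣≡∑χχ : ∀ (p q : Subset n) → ∣ p ∩ q ∣ ≡ ∑[ i < n ] (χ p i * χ q i)
∣p∩q∣≡∑χχ p q = trans (∣p∣≡∑χ (p ∩ q)) (sum-cong-≗ (χ-∩ p q))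

∑-mono-≤ : ∀ {f g : Fin n → ℕ} → (∀ i → f i ≤ g i) → ∑[ i < n ] f i ≤ ∑[ i < n ] g i
∑-mono-≤ {zero}  f≤g = z≤n
∑-mono-≤ {suc n} f≤g = +-mono-≤ (f≤g zero) (∑-mono-≤ (λ i → f≤g (suc i)))

∑χ*-const : ∀ (p : Subset n) (f : Fin n → ℕ) {c} → (∀ {i} → i ∈ p → f i ≡ c) →
            ∑[ i < n ] (χ p i * f i) ≡ ∣ p ∣ * c
∑χ*-const {n} p f {c} f≡c = begin
  ∑[ i < n ] (χ p i * f i)  ≡⟨ sum-cong-≗ restrict ⟩
  ∑[ i < n ] (χ p i * c)    ≡⟨ *-distribʳ-sum c (χ p) ⟨
  (∑[ i < n ] χ p i) * c    ≡⟨ cong (_* c) (∣p∣≡∑χ p) ⟨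
  ∣ p ∣ * c                 ∎
  where
  open ≡-Reasoning
  restrict : ∀ x → χ p x * f x ≡ χ p x * c
  restrict x with x ∈? p
  ... | yes x∈p = cong (χ p x *_) (f≡c x∈p)
  ... | no  x∉p rewrite χ-∉ x∉p = refl

Empty⇒∣p∣≡0 : Empty p → ∣ p ∣ ≡ 0
Empty⇒∣p∣≡0 {n} empty = trans (cong ∣_∣ (Empty-unique empty)) (∣⊥∣≡0 n)

x∈p⇒1≤∣p∣ : x ∈ p → 1 ≤ ∣ p ∣
x∈p⇒1≤∣p∣ x∈p = ≤-trans (s≤s z≤n) (x∈p⇒∣p-x∣<∣p∣ x∈p)

1≤∣p∣⇒Nonempty : 1 ≤ ∣ p ∣ → Nonempty p
1≤∣p∣⇒Nonempty {p = p} 1≤∣p∣ with nonempty? p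
... | yes ne    = ne
... | no  empty = contradiction (sym (Empty⇒∣p∣≡0 empty)) (<⇒≢ 1≤∣p∣)

∣p∣≤1⇒unique : ∣ p ∣ ≤ 1 → x ∈ p → y ∈ p → x ≡ y
∣p∣≤1⇒unique ∣p∣≤1 here        here        = refl
∣p∣≤1⇒unique ∣p∣≤1 here        (there y∈p) = contradiction (s≤s⁻¹ ∣p∣≤1) (<⇒≱ (x∈p⇒1≤∣p∣ y∈p))
∣p∣≤1⇒unique ∣p∣≤1 (there x∈p) here        = contradiction (s≤s⁻¹ ∣p∣≤1) (<⇒≱ (x∈p⇒1≤∣p∣ x∈p))
∣p∣≤1⇒unique {p = s ∷ p} ∣p∣≤1 (there x∈p) (there y∈p) =
  cong suc (∣p∣≤1⇒unique (≤-trans (∣p∣≤∣x∷p∣ s p) ∣p∣≤1) x∈p y∈p)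

unique⇒∣p∣≤1 : (∀ {i i′} → i ∈ p → i′ ∈ p → i ≡ i′) → ∣ p ∣ ≤ 1
unique⇒∣p∣≤1 {p = []}          unique = z≤n
unique⇒∣p∣≤1 {p = outside ∷ p} unique = unique⇒∣p∣≤1 (λ x∈p y∈p → Fin.suc-injective (unique (there x∈p) (there y∈p)))
unique⇒∣p∣≤1 {p = inside  ∷ p} unique =
  s≤s (≤-reflexive (Empty⇒∣p∣≡0 empty))
  where
  empty : Empty p
  empty (y , y∈p) with unique here (there y∈p)
  ... | ()

∣p∩q∣+∣p∩∁q∣≡∣p∣ : ∀ (p q : Subset n) → ∣ p ∩ q ∣ + ∣ p ∩ ∁ q ∣ ≡ ∣ p ∣
∣p∩q∣+∣p∩∁q∣≡∣p∣ []            []            = refl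
∣p∩q∣+∣p∩∁q∣≡∣p∣ (inside  ∷ p) (inside  ∷ q) = cong suc (∣p∩q∣+∣p∩∁q∣≡∣p∣ p q)
∣p∩q∣+∣p∩∁q∣≡∣p∣ (inside  ∷ p) (outside ∷ q) =
  trans (+-suc ∣ p ∩ q ∣ ∣ p ∩ ∁ q ∣) (cong suc (∣p∩q∣+∣p∩∁q∣≡∣p∣ p q))
∣p∩q∣+∣p∩∁q∣≡∣p∣ (outside ∷ p) (_       ∷ q) = ∣p∩q∣+∣p∩∁q∣≡∣p∣ p q

⊆-of-size : ∀ m (p : Subset n) → m ≤ ∣ p ∣ → ∃ λ q → q ⊆ p × ∣ q ∣ ≡ m
⊆-of-size {n} zero    p             _           = ⊥ , (λ x∈⊥ → contradiction x∈⊥ ∉⊥) , ∣⊥∣≡0 n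
⊆-of-size     (suc m) (inside  ∷ p) (s≤s m≤∣p∣) with ⊆-of-size m p m≤∣p∣
... | q , q⊆p , ∣q∣≡m = inside ∷ q , (λ { here → here ; (there x∈q) → there (q⊆p x∈q) }) , cong suc ∣q∣≡m
⊆-of-size     (suc m) (outside ∷ p) m<∣p∣       with ⊆-of-size (suc m) p m<∣p∣
... | q , q⊆p , ∣q∣≡m = outside ∷ q , (λ { (there x∈q) → there (q⊆p x∈q) }) , ∣q∣≡m

n<∣∁p∣+m : ∀ (p : Subset n) {m} → ∣ p ∣ < m → n < ∣ ∁ p ∣ + m
n<∣∁p∣+m {n} p {m} ∣p∣<m = begin-strict
  n                  ≡⟨ m∸n+n≡m (∣p∣≤n p) ⟨
  n ∸ ∣ p ∣ + ∣ p ∣  ≡⟨ cong (_+ ∣ p ∣) (∣∁p∣≡n∸∣p∣ p) ⟨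
  ∣ ∁ p ∣ + ∣ p ∣    <⟨ +-monoʳ-< ∣ ∁ p ∣ ∣p∣<m ⟩
  ∣ ∁ p ∣ + m        ∎
  where open ≤-Reasoning

does-∈? : ∀ x (p : Subset n) → does (x ∈? p) ≡ lookup p x
does-∈? zero    (inside  ∷ p) = refl
does-∈? zero    (outside ∷ p) = refl
does-∈? (suc x) (_       ∷ p) = does-∈? x p

degreeIn : (B : Fin j → Subset n) → Subset j → Fin n → ℕ
degreeIn B A v = ∣ A ∩ blocksOf B v ∣

module _ {n j : ℕ} {B : Fin j → Subset n} where

  private variable
    b : Fin j
    v : Fin n
    A : Subset j
    I J : Subset n

  lookup-blocksOf : ∀ v b → lookup (blocksOf B v) b ≡ lookup (B b) v
  lookup-blocksOf v b = trans (lookup∘tabulate _ b) (does-∈? v (B b))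

  ∈-blocksOf⁺ : v ∈ B b → b ∈ blocksOf B v
  ∈-blocksOf⁺ {v} {b} v∈b = lookup⇒[]= b (blocksOf B v) (trans (lookup-blocksOf v b) ([]=⇒lookup v∈b))

  ∈-blocksOf⁻ : b ∈ blocksOf B v → v ∈ B b
  ∈-blocksOf⁻ {b} {v} b∈ = lookup⇒[]= v (B b) (trans (sym (lookup-blocksOf v b)) ([]=⇒lookup b∈))

  ∈⇒1≤degreeIn : b ∈ A → v ∈ B b → 1 ≤ degreeIn B A v
  ∈⇒1≤degreeIn b∈A v∈b = x∈p⇒1≤∣p∣ (x∈p∩q⁺ (b∈A , ∈-blocksOf⁺ v∈b))

  degreeIn≡1⇒InExactlyOne : 1 ≤ degreeIn B A v → degreeIn B A v ≤ 1 → InExactlyOne B A v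
  degreeIn≡1⇒InExactlyOne {A} {v} 1≤d d≤1 with 1≤∣p∣⇒Nonempty 1≤d
  ... | b , b∈ with x∈p∩q⁻ A (blocksOf B v) b∈
  ...   | b∈A , b∈v = b , b∈A , ∈-blocksOf⁻ b∈v ,
                      λ b′ b′∈A v∈b′ → ∣p∣≤1⇒unique d≤1 (x∈p∩q⁺ (b′∈A , ∈-blocksOf⁺ v∈b′)) b∈

  ∑-degreeIn : ∀ (A : Subset j) (X : Subset n) →
               ∑[ v < n ] (χ X v * degreeIn B A v) ≡ ∑[ b < j ] (χ A b * ∣ B b ∩ X ∣)
  ∑-degreeIn A X = begin
    ∑[ v < n ] (χ X v * degreeIn B A v)                  ≡⟨ sum-cong-≗ (λ v → cong (χ X v *_) (degree-as-sum v)) ⟩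
    ∑[ v < n ] (χ X v * ∑[ b < j ] (χ A b * χ (B b) v)) ≡⟨ sum-cong-≗ (λ v → *-distribˡ-sum (χ X v) (λ b → χ A b * χ (B b) v)) ⟩
    ∑[ v < n ] ∑[ b < j ] (χ X v * (χ A b * χ (B b) v)) ≡⟨ ∑-comm (λ v b → χ X v * (χ A b * χ (B b) v)) ⟩
    ∑[ b < j ] ∑[ v < n ] (χ X v * (χ A b * χ (B b) v)) ≡⟨ sum-cong-≗ (λ b → sum-cong-≗ (λ v → rotate (χ X v) (χ A b) (χ (B b) v))) ⟩
    ∑[ b < j ] ∑[ v < n ] (χ A b * (χ (B b) v * χ X v)) ≡⟨ sum-cong-≗ (λ b → *-distribˡ-sum (χ A b) (λ v → χ (B b) v * χ X v)) ⟨
    ∑[ b < j ] (χ A b * ∑[ v < n ] (χ (B b) v * χ X v)) ≡⟨ sum-cong-≗ (λ b → cong (χ A b *_) (∣p∩q∣≡∑χχ (B b) X)) ⟨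
    ∑[ b < j ] (χ A b * ∣ B b ∩ X ∣)                  ∎
    where
    open ≡-Reasoning
    degree-as-sum : ∀ v → degreeIn B A v ≡ ∑[ b < j ] (χ A b * χ (B b) v)
    degree-as-sum v = trans (∣p∩q∣≡∑χχ A (blocksOf B v))
      (sum-cong-≗ (λ b → cong (χ A b *_) (χ-cong ∈-blocksOf⁻ ∈-blocksOf⁺)))
    rotate : ∀ a c d → a * (c * d) ≡ c * (d * a)
    rotate a c d = trans (*-comm a (c * d)) (*-assoc c d a)

  Independent-⊆ : J ⊆ I → Independent B I → Independent B J
  Independent-⊆ J⊆I ind u v u∈J v∈J = ind u v (J⊆I u∈J) (J⊆I v∈J)

  Independent⇒∣block∩I∣≤1 : Independent B I → ∀ b → ∣ B b ∩ I ∣ ≤ 1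
  Independent⇒∣block∩I∣≤1 {I} ind b = unique⇒∣p∣≤1 same
    where
    same : ∀ {u v} → u ∈ B b ∩ I → v ∈ B b ∩ I → u ≡ v
    same {u} {v} u∈ v∈ with u ≟ v
    ... | yes u≡v = u≡v
    ... | no  u≢v = contradiction (b , proj₁ (x∈p∩q⁻ (B b) I u∈) , proj₁ (x∈p∩q⁻ (B b) I v∈))
                                  (ind u v (proj₂ (x∈p∩q⁻ (B b) I u∈)) (proj₂ (x∈p∩q⁻ (B b) I v∈)) u≢v)

  Independent⇒∣I∣<p : ∀ {p} → Lottery B p 2 → Independent B I → ∣ I ∣ < p
  Independent⇒∣I∣<p {I} {p} lottery ind with p ≤? ∣ I ∣
  ... | no  p≰∣I∣ = ≰⇒> p≰∣I∣
  ... | yes p≤∣I∣ with ⊆-of-size p I p≤∣I∣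
  ...   | D , D⊆I , ∣D∣≡p with lottery D ∣D∣≡p
  ...     | b , 2≤∣b∩D∣ = contradiction (Independent⇒∣block∩I∣≤1 (Independent-⊆ D⊆I ind) b) (<⇒≱ 2≤∣b∩D∣)

  MaximalIndependent⇒absorbs : MaximalIndependent B I → (∀ b → v ∈ B b → Empty (B b ∩ I)) → v ∈ I
  MaximalIndependent⇒absorbs {I} {v} (ind , maximal) avoids =
    maximal (I ∪ ⁅ v ⁆) ind′ (p⊆p∪q ⁅ v ⁆) (x∈p∪q⁺ (inj₂ (x∈⁅x⁆ v)))
    where
    ind′ : Independent B (I ∪ ⁅ v ⁆)
    ind′ x y x∈ y∈ x≢y (b , x∈b , y∈b) with x∈p∪q⁻ I ⁅ v ⁆ x∈ | x∈p∪q⁻ I ⁅ v ⁆ y∈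
    ... | inj₁ x∈I | inj₁ y∈I = ind x y x∈I y∈I x≢y (b , x∈b , y∈b)
    ... | inj₂ x∈v | inj₁ y∈I rewrite x∈⁅y⁆⇒x≡y v x∈v = avoids b x∈b (y , x∈p∩q⁺ (y∈b , y∈I))
    ... | inj₁ x∈I | inj₂ y∈v rewrite x∈⁅y⁆⇒x≡y v y∈v = avoids b y∈b (x , x∈p∩q⁺ (x∈b , x∈I))
    ... | inj₂ x∈v | inj₂ y∈v = x≢y (trans (x∈⁅y⁆⇒x≡y v x∈v) (sym (x∈⁅y⁆⇒x≡y v y∈v)))

  Isolated⇒meets-MaximalIndependent : MaximalIndependent B I → Isolated B b → Nonempty (B b) →
                                      Nonempty (B b ∩ I)
  Isolated⇒meets-MaximalIndependent {I} {b} maximal isolated (u , u∈b) with nonempty? (B b ∩ I)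
  ... | yes meets = meets
  ... | no  misses = contradiction (u , x∈p∩q⁺ (u∈b , u∈I)) misses
    where
    u∈I : u ∈ I
    u∈I = MaximalIndependent⇒absorbs maximal avoids
      where
      avoids : ∀ b′ → u ∈ B b′ → Empty (B b′ ∩ I)
      avoids b′ u∈b′ with b′ ≟ b
      ... | yes refl = misses
      ... | no  b′≢b = contradiction (u , x∈p∩q⁺ (u∈b , u∈b′)) (isolated b′ b′≢b)

module _ {n j k : ℕ} {B : Fin j → Subset n} (0<k : 0 < k) (uniform : Uniform B k) (segregated : Segregated B)
         {S I BI F} (isIsolated : IsIsolatedBlocks B S) (maximal : MaximalIndependent B I)
         (isBI : IsBlocksMeeting B I BI) (isF : IsF B BI F) where

  private variable
    b : Fin j
    v : Fin n
    A : Subset j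

  S⊆BI : S ⊆ BI
  S⊆BI {b} b∈S = proj₂ (isBI b)
    (Isolated⇒meets-MaximalIndependent maximal (proj₁ (isIsolated b) b∈S)
      (1≤∣p∣⇒Nonempty (subst (0 <_) (sym (uniform b)) 0<k)))

  ∣block∩∁I∣≡k∸1 : b ∈ BI → ∣ B b ∩ ∁ I ∣ ≡ k ∸ 1
  ∣block∩∁I∣≡k∸1 {b} b∈BI = begin
    ∣ B b ∩ ∁ I ∣                    ≡⟨ cong (λ m → m + ∣ B b ∩ ∁ I ∣ ∸ 1) ∣block∩I∣≡1 ⟨
    ∣ B b ∩ I ∣ + ∣ B b ∩ ∁ I ∣ ∸ 1  ≡⟨ cong (_∸ 1) (trans (∣p∩q∣+∣p∩∁q∣≡∣p∣ (B b) I) (uniform b)) ⟩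
    k ∸ 1                            ∎
    where
    open ≡-Reasoning
    ∣block∩I∣≡1 : ∣ B b ∩ I ∣ ≡ 1
    ∣block∩I∣≡1 = ≤-antisym (Independent⇒∣block∩I∣≤1 (proj₁ maximal) b)
                            (x∈p⇒1≤∣p∣ (proj₂ (proj₁ (isBI b) b∈BI)))

  1≤degreeIn-BI : v ∉ I → 1 ≤ degreeIn B BI v
  1≤degreeIn-BI {v} v∉I with 1 ≤? degreeIn B BI v
  ... | yes 1≤d = 1≤d
  ... | no  1≰d = contradiction (MaximalIndependent⇒absorbs maximal avoids) v∉I
    where
    avoids : ∀ b → v ∈ B b → Empty (B b ∩ I)
    avoids b v∈b meets = 1≰d (∈⇒1≤degreeIn (proj₂ (isBI b) meets) v∈b)

  outside-I-weight≥2 : v ∉ I → 2 ≤ degreeIn B BI v + degreeIn B S v + χ F v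
  outside-I-weight≥2 {v} v∉I with 2 ≤? degreeIn B BI v | v ∈? F
  ... | yes 2≤dBI | _ = ≤-trans 2≤dBI (≤-trans (m≤m+n _ _) (m≤m+n _ _))
  ... | no  _     | yes v∈F rewrite χ-∈ v∈F = +-monoˡ-≤ 1 (≤-trans (1≤degreeIn-BI v∉I) (m≤m+n _ _))
  ... | no  2≰dBI | no  v∉F with proj₂ segregated v degree≡1
    where
    exactlyOne : InExactlyOne B BI v
    exactlyOne = degreeIn≡1⇒InExactlyOne (1≤degreeIn-BI v∉I) (≤-pred (≰⇒> 2≰dBI))
    degree≡1 : degree B v ≡ 1
    degree≡1 = ≤-antisym (≤-pred (≰⇒> (λ 2≤deg → v∉F (proj₂ (isF v) (2≤deg , exactlyOne)))))
                         (proj₁ segregated v)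
  ...   | b , v∈b , isolated =
    ≤-trans (+-mono-≤ (1≤degreeIn-BI v∉I) (∈⇒1≤degreeIn (proj₂ (isIsolated b) isolated) v∈b)) (m≤m+n _ _)

  ∑-outside-degreeIn : A ⊆ BI → ∑[ v < n ] (χ (∁ I) v * degreeIn B A v) ≡ ∣ A ∣ * (k ∸ 1)
  ∑-outside-degreeIn {A} A⊆BI = trans (∑-degreeIn A (∁ I))
    (∑χ*-const A (λ b → ∣ B b ∩ ∁ I ∣) (λ b∈A → ∣block∩∁I∣≡k∸1 (A⊆BI b∈A)))

  2*∣∁I∣-bound : 2 * ∣ ∁ I ∣ ≤ (k ∸ 1) * (∣ BI ∣ + ∣ S ∣) + ∣ F ∣
  2*∣∁I∣-bound = begin
    2 * ∣ ∁ I ∣                                   ≡⟨ cong (2 *_) (∣p∣≡∑χ (∁ I)) ⟩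
    2 * ∑[ v < n ] χ (∁ I) v                       ≡⟨ *-distribˡ-sum 2 (χ (∁ I)) ⟩
    ∑[ v < n ] (2 * χ (∁ I) v)                     ≤⟨ ∑-mono-≤ weight ⟩
    ∑[ v < n ] (dBI v + dS v + χ F v)              ≡⟨ ∑-distrib-+ (λ v → dBI v + dS v) (χ F) ⟩
    ∑[ v < n ] (dBI v + dS v) + ∑[ v < n ] χ F v   ≡⟨ cong₂ _+_ (∑-distrib-+ dBI dS) (sym (∣p∣≡∑χ F)) ⟩
    ∑[ v < n ] dBI v + ∑[ v < n ] dS v + ∣ F ∣     ≡⟨ cong₂ (λ a c → a + c + ∣ F ∣) (∑-outside-degreeIn ⊆-refl) (∑-outside-degreeIn S⊆BI) ⟩
    ∣ BI ∣ * (k ∸ 1) + ∣ S ∣ * (k ∸ 1) + ∣ F ∣     ≡⟨ cong (_+ ∣ F ∣) (trans (*-comm (k ∸ 1) _) (*-distribʳ-+ (k ∸ 1) ∣ BI ∣ ∣ S ∣)) ⟨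
    (k ∸ 1) * (∣ BI ∣ + ∣ S ∣) + ∣ F ∣             ∎
    where
    open ≤-Reasoning
    dBI dS : Fin n → ℕ
    dBI v = χ (∁ I) v * degreeIn B BI v
    dS  v = χ (∁ I) v * degreeIn B S v
    weight : ∀ v → 2 * χ (∁ I) v ≤ dBI v + dS v + χ F v
    weight v with v ∈? I
    ... | yes v∈I rewrite χ-∉ (x∈p⇒x∉∁p v∈I) = z≤n
    ... | no  v∉I rewrite χ-∈ (x∉p⇒x∈∁p v∉I) | *-identityˡ (degreeIn B BI v) | *-identityˡ (degreeIn B S v) =
      outside-I-weight≥2 v∉I

ℕ-bound⇒ℤ-bound : ∀ x y z w u → x + z ≤ w + u + y → + x - + y +ℤ + z - + w ≤ℤ + u
ℕ-bound⇒ℤ-bound x y z w u x+z≤w+u+y =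
  ℤₚ.i-j≤0⇒i≤j (subst (_≤ℤ + 0) rearranged (ℤₚ.i≤j⇒i-j≤0 (+≤+ x+z≤w+u+y)))
  where
  ring : ∀ (a b c d e : ℤ) → (a +ℤ c) - ((d +ℤ e) +ℤ b) ≡ a - b +ℤ c - d - e
  ring = solve-∀
  rearranged : + (x + z) - + (w + u + y) ≡ + x - + y +ℤ + z - + w - + u
  rearranged rewrite ℤₚ.pos-+ x z | ℤₚ.pos-+ (w + u) y | ℤₚ.pos-+ w u = ring (+ x) (+ y) (+ z) (+ w) (+ u)

lemma3p16 : (n k p j r : ℕ) → 2 ≤ k → k ≤ n →
    (B : Fin j → Subset n) → Injective _≡_ _≡_ B →
    Uniform B k → Lottery B p 2 → Segregated B →
    (S : Subset j) → IsIsolatedBlocks B S → ∣ S ∣ ≡ r →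
    (I : Subset n) → MaximalIndependent B I →
    (BI : Subset j) → IsBlocksMeeting B I BI →
    (F : Subset n) → IsF B BI F →
    + ∣ F ∣ ≥ + (2 Data.Nat.* n) - + (2 Data.Nat.* p) Data.Integer.+ + 2
    - + ((k ∸ 1) Data.Nat.* (∣ BI ∣ Data.Nat.+ r))
lemma3p16 n k p j _ 2≤k _ B _ uniform lottery segregated S isIsolated refl I maximal BI isBI F isF =
  ℕ-bound⇒ℤ-bound (2 * n) (2 * p) 2 ((k ∸ 1) * (∣ BI ∣ + ∣ S ∣)) ∣ F ∣ (begin
    2 * n + 2                                        ≡⟨ +-comm (2 * n) 2 ⟩
    2 + 2 * n                                        ≡⟨ *-suc 2 n ⟨
    2 * suc n                                        ≤⟨ *-monoʳ-≤ 2 (n<∣∁p∣+m I (Independent⇒∣I∣<p lottery (proj₁ maximal))) ⟩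
    2 * (∣ ∁ I ∣ + p)                                ≡⟨ *-distribˡ-+ 2 ∣ ∁ I ∣ p ⟩
    2 * ∣ ∁ I ∣ + 2 * p                              ≤⟨ +-monoˡ-≤ (2 * p) (2*∣∁I∣-bound (≤-trans (s≤s z≤n) 2≤k) uniform segregated isIsolated maximal isBI isF) ⟩
    (k ∸ 1) * (∣ BI ∣ + ∣ S ∣) + ∣ F ∣ + 2 * p       ∎)
  where open ≤-Reasoning
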